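{- Let $\ell$ and $n$ be integers with $1\le \ell\le n/2$. Then there exists an edge-coloured complete graph $K_n^c$ on $n$ vertices with $\Delta_{\mathrm{mon}}(K_n^c)=n-\ell$ and $\delta^c(K_n^c)=\ell$ such that all properly coloured cycles in $K_n^c$ have length less than $2\ell$ and all properly coloured paths in $K_n^c$ have length less than $2\ell+1$.
   Context: $K_n^c$ denotes $K_n$ with an edge-colouring. $\Delta_{\mathrm{mon}}(K_n^c)$ is the maximum, over vertices $v$ and colours $a$, of the number of edges of colour $a$ at $v$. $\delta^c(K_n^c)$ is the minimum over vertices of the number of distinct colours on edges at that vertex. A path or cycle is properly coloured if no two adjacent edges of it have the same colour. -}

module Defs where

open import Data.Nat using (ℕ; zero; suc; _+_; _∸_; _≤_; _<_; _≥_)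
import Data.Nat as ℕ
open import Data.Fin using (Fin)
import Data.Fin as F
open import Data.List using (List; []; _∷_; _++_; length; take; filter; map; deduplicate)
open import Data.List.Base using (allFin)
open import Data.List.Relation.Unary.Unique.Propositional using (Unique)
open import Data.Product using (Σ; _×_; ∃; ∃-syntax; _,_)
open import Relation.Binary.PropositionalEquality using (_≡_; _≢_)
open import Relation.Nullary using (¬_)
open import Relation.Nullary.Decidable using (¬?; _×-dec_)

-- Values c v v are
-- irrelevant (never used: all counts exclude u = v, paths/cycles have
-- distinct vertices).
record EdgeColouring (n : ℕ) : Set where
  field
    col : Fin n → Fin n → ℕ
    sym : ∀ u v → col u v ≡ col v u
open EdgeColouring public

others : ∀ {n} → Fin n → List (Fin n)
others {n} v = filter (λ u → ¬? (u F.≟ v)) (allFin n)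

monDeg : ∀ {n} → EdgeColouring n → Fin n → ℕ → ℕ
monDeg c v a = length (filter (λ u → col c v u ℕ.≟ a) (others v))

colDeg : ∀ {n} → EdgeColouring n → Fin n → ℕ
colDeg c v = length (deduplicate ℕ._≟_ (map (col c v) (others v)))

MaxMonDegIs : ∀ {n} → EdgeColouring n → ℕ → Set
MaxMonDegIs c m = (∀ v a → monDeg c v a ≤ m) × (∃[ v ] ∃[ a ] monDeg c v a ≡ m)

MinColDegIs : ∀ {n} → EdgeColouring n → ℕ → Set
MinColDegIs c m = (∀ v → m ≤ colDeg c v) × (∃[ v ] colDeg c v ≡ m)

data ProperSeq {n} (c : EdgeColouring n) : List (Fin n) → Set where
  []   : ProperSeq c []
  [_]  : ∀ x → ProperSeq c (x ∷ [])
  [_,_] : ∀ x y → ProperSeq c (x ∷ y ∷ [])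
  step : ∀ {x y z rest} → col c x y ≢ col c y z →
         ProperSeq c (y ∷ z ∷ rest) → ProperSeq c (x ∷ y ∷ z ∷ rest)

PCPath : ∀ {n} → EdgeColouring n → ℕ → Set
PCPath {n} c k = Σ (List (Fin n)) λ vs →
  (length vs ≡ suc k) × Unique vs × ProperSeq c vs

-- properly coloured cycle of length k ≥ 3: distinct vertices v0 … v(k-1),
-- edges v_i v_{i+1} (indices mod k); consecutive edges, including the
-- wrap-around pairs, have different colours.
PCCycle : ∀ {n} → EdgeColouring n → ℕ → Set
PCCycle {n} c k = Σ (List (Fin n)) λ vs →
  (k ≥ 3) × (length vs ≡ k) × Unique vs × ProperSeq c (vs ++ take 2 vs)

module Submission where

-- Construction (ℓ = suc m): vertices are labelled 0 … n − 1 and the labels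
-- below ℓ form the core.  Core vertices a, b are joined in colour ℓ + a + b,
-- a core vertex a and an outer vertex in colour a, two outer vertices in 0.
--
-- For an arbitrary colouring, a rainbow star of size s at v
-- (s neighbours joined to v in distinct colours) gives colDeg v ≥ s and
-- monDeg v a ≤ n − s.  Every vertex has a rainbow star of size ℓ, while
-- the origin 0 sees only ℓ colours and sees colour 0 on n − ℓ edges.
--
-- Call 0 the root, the other core vertices inner and
-- the rest outer.  A credit on directed edges (2 from inner to outer, 0
-- from outer to inner, 1 otherwise) drops by one at each outer vertex of a
-- properly coloured walk and rises by at most one at each inner vertex,
-- because every other window is monochromatic.  Telescoping, a cycle has at
-- most as many outer as inner vertices and a path at most two more; as a
-- path meets at most ℓ − 1 inner vertices and the root once, cycles have at
-- most 2ℓ − 1 vertices and paths at most 2ℓ + 1.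

open import Defs hiding (sym)
open import Data.Nat using (ℕ; _+_; _*_; _∸_; _≤_; _<_)
open import Data.Product using (Σ; _×_)

open import Data.Nat using (zero; suc; z≤n; s≤s)
open import Data.Nat.Properties
open import Data.Product using (_,_; proj₁; proj₂; uncurry)
open import Data.Nat.Tactic.RingSolver using (solve-∀)
open import Data.Sum using (_⊎_; inj₁; inj₂)
open import Data.Empty using (⊥-elim)
open import Data.Fin using (Fin; toℕ; fromℕ<)
import Data.Fin as F
open import Data.Fin.Properties using (toℕ-injective; toℕ<n; toℕ-fromℕ<)
open import Data.List using (List; []; _∷_; _++_; length; map; filter; allFin; deduplicate; tabulate; applyUpTo)
open import Data.List.Properties using (length-++; length-map; length-tabulate; length-applyUpTo; filter-none; filter-++; filter-accept; filter-reject)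
open import Data.List.Membership.Propositional using (_∈_)
open import Data.List.Membership.Propositional.Properties
  using (∈-∃++; ∈-++⁻; ∈-++⁺ˡ; ∈-++⁺ʳ; ∈-map⁺; ∈-map⁻; ∈-filter⁺; ∈-filter⁻; ∈-allFin; ∈-deduplicate⁺; ∈-deduplicate⁻; ∈-applyUpTo⁺)
open import Data.List.Relation.Binary.Subset.Propositional using (_⊆_)
open import Data.List.Relation.Unary.Any using (here; there)
open import Data.List.Relation.Unary.All as All using (All)
import Data.List.Relation.Unary.All.Properties as AllProps
open import Data.List.Relation.Unary.AllPairs as AllPairs using (AllPairs; _∷_)
import Data.List.Relation.Unary.AllPairs.Properties as AllPairs
open import Data.List.Relation.Unary.Unique.Propositional using (Unique)
import Data.List.Relation.Unary.Unique.Propositional.Properties as Unique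
open import Data.List.Relation.Unary.Unique.DecPropositional.Properties _≟_ using (deduplicate-!)
open import Relation.Binary.PropositionalEquality using (_≡_; _≢_; refl; sym; trans; cong; cong₂; subst; subst₂; ≢-sym; module ≡-Reasoning)
open import Relation.Nullary using (Dec; yes; no; ¬?)
open import Relation.Unary using (Decidable)
open import Relation.Unary.Properties using (∁?)

unique-⊆⇒length≤ : ∀ {A : Set} (xs ys : List A) → Unique xs → xs ⊆ ys → length xs ≤ length ys
unique-⊆⇒length≤ [] ys _ _ = z≤n
unique-⊆⇒length≤ (x ∷ xs) ys (x∉xs ∷ xs!) xs⊆ys with ∈-∃++ (xs⊆ys (here refl))
... | us , vs , refl = begin
  suc (length xs)            ≤⟨ s≤s (unique-⊆⇒length≤ xs (us ++ vs) xs! xs⊆us++vs) ⟩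
  suc (length (us ++ vs))    ≡⟨ cong suc (length-++ us) ⟩
  suc (length us + length vs) ≡⟨ sym (+-suc (length us) (length vs)) ⟩
  length us + suc (length vs) ≡⟨ sym (length-++ us) ⟩
  length (us ++ x ∷ vs)      ∎
  where
  open ≤-Reasoning
  xs⊆us++vs : xs ⊆ us ++ vs
  xs⊆us++vs y∈xs with ∈-++⁻ us (xs⊆ys (there y∈xs))
  ... | inj₁ y∈us = ∈-++⁺ˡ y∈us
  ... | inj₂ (here refl) = ⊥-elim (All.lookup x∉xs y∈xs refl)
  ... | inj₂ (there y∈vs) = ∈-++⁺ʳ us y∈vs

length-filter-∁ : ∀ {A : Set} {P : A → Set} (P? : Decidable P) xs →
  length xs ≡ length (filter P? xs) + length (filter (∁? P?) xs)
length-filter-∁ P? [] = refl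
length-filter-∁ P? (x ∷ xs) with P? x
... | yes _ = cong suc (length-filter-∁ P? xs)
... | no _ = trans (cong suc (length-filter-∁ P? xs)) (sym (+-suc _ _))

atMostOneWithValue : ∀ {A : Set} (f : A → ℕ) a xs → AllPairs (λ x y → f x ≢ f y) xs →
  length (filter (λ x → f x ≟ a) xs) ≤ 1
atMostOneWithValue f a [] _ = z≤n
atMostOneWithValue {A} f a (x ∷ xs) (fx∉ ∷ xs!) with f x ≟ a
... | yes fx≡a = ≤-reflexive (cong length (begin
  filter hasValue? (x ∷ xs) ≡⟨ filter-accept hasValue? fx≡a ⟩
  x ∷ filter hasValue? xs   ≡⟨ cong (x ∷_) (filter-none hasValue? (All.map (λ ne eq → ne (trans fx≡a (sym eq))) fx∉)) ⟩
  x ∷ []                    ∎))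
  where
  open ≡-Reasoning
  hasValue? : (y : A) → Dec (f y ≡ a)
  hasValue? y = f y ≟ a
... | no fx≢a = subst (_≤ 1) (sym (cong length (filter-reject (λ y → f y ≟ a) fx≢a))) (atMostOneWithValue f a xs xs!)

module _ {n : ℕ} where

  ∈-others⁺ : {u v : Fin n} → u ≢ v → u ∈ others v
  ∈-others⁺ {u} {v} u≢v = ∈-filter⁺ (λ w → ¬? (w F.≟ v)) (∈-allFin u) u≢v

  ∈-others⁻ : {u v : Fin n} → u ∈ others v → u ≢ v
  ∈-others⁻ {u} {v} u∈ = proj₂ (∈-filter⁻ (λ w → ¬? (w F.≟ v)) {xs = allFin n} u∈)

  others-unique : (v : Fin n) → Unique (others v)
  others-unique v = Unique.filter⁺ (λ w → ¬? (w F.≟ v)) (Unique.allFin⁺ n)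

RainbowStar : ∀ {n} → EdgeColouring n → Fin n → List (Fin n) → Set
RainbowStar c v us = All (_≢ v) us × AllPairs (λ x y → col c v x ≢ col c v y) us

module _ {n : ℕ} (c : EdgeColouring n) (v : Fin n) where

  colourClass : ℕ → List (Fin n)
  colourClass a = filter (λ u → col c v u ≟ a) (others v)

  rainbow-unique : ∀ {us} → RainbowStar c v us → Unique us
  rainbow-unique (_ , distinct) = AllPairs.map (λ ne eq → ne (cong (col c v) eq)) distinct

  -- The colours of a rainbow star are distinct colours seen at v.
  rainbow⇒colDeg≥ : ∀ {us} → RainbowStar c v us → length us ≤ colDeg c v
  rainbow⇒colDeg≥ {us} (avoid , distinct) = begin
    length us                 ≡⟨ sym (length-map (col c v) us) ⟩
    length (map (col c v) us) ≤⟨ unique-⊆⇒length≤ _ _ (AllPairs.map⁺ distinct) coloursSeen ⟩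
    colDeg c v                ∎
    where
    open ≤-Reasoning
    coloursSeen : map (col c v) us ⊆ deduplicate _≟_ (map (col c v) (others v))
    coloursSeen a∈ with ∈-map⁻ (col c v) a∈
    ... | u , u∈us , refl = ∈-deduplicate⁺ _≟_ (∈-map⁺ (col c v) (∈-others⁺ (All.lookup avoid u∈us)))

  -- v, its neighbours of colour a and the leaves of a rainbow star whose
  -- colour is not a are distinct vertices; at most one leaf has colour a.
  rainbow⇒monDeg≤ : ∀ {us} → RainbowStar c v us → ∀ a → monDeg c v a + length us ≤ n
  rainbow⇒monDeg≤ {us} star@(avoid , distinct) a = begin
    monDeg c v a + length us              ≤⟨ +-monoʳ-≤ (monDeg c v a) leaves≤ ⟩
    monDeg c v a + suc (length otherLeaves) ≡⟨ +-suc (monDeg c v a) _ ⟩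
    suc (length (colourClass a) + length otherLeaves) ≡⟨ cong suc (sym (length-++ (colourClass a))) ⟩
    length (v ∷ colourClass a ++ otherLeaves) ≤⟨ unique-⊆⇒length≤ _ (allFin n) distinctVertices (λ {u} _ → ∈-allFin u) ⟩
    length (allFin n)                     ≡⟨ length-tabulate (λ u → u) ⟩
    n                                     ∎
    where
    open ≤-Reasoning
    ofColour? : (u : Fin n) → Dec (col c v u ≡ a)
    ofColour? u = col c v u ≟ a

    otherLeaves : List (Fin n)
    otherLeaves = filter (∁? ofColour?) us

    leaves≤ : length us ≤ suc (length otherLeaves)
    leaves≤ = begin
      length us                                          ≡⟨ length-filter-∁ ofColour? us ⟩
      length (filter ofColour? us) + length otherLeaves  ≤⟨ +-monoˡ-≤ _ (atMostOneWithValue (col c v) a us distinct) ⟩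
      suc (length otherLeaves)                           ∎

    notV : ∀ {u} → u ∈ colourClass a ++ otherLeaves → v ≢ u
    notV {u} u∈ with ∈-++⁻ (colourClass a) u∈
    ... | inj₁ u∈class = ≢-sym (∈-others⁻ (proj₁ (∈-filter⁻ ofColour? {xs = others v} u∈class)))
    ... | inj₂ u∈leaves = ≢-sym (All.lookup avoid (proj₁ (∈-filter⁻ (∁? ofColour?) {xs = us} u∈leaves)))

    distinctVertices : Unique (v ∷ colourClass a ++ otherLeaves)
    distinctVertices = All.tabulate notV
      ∷ Unique.++⁺ (Unique.filter⁺ ofColour? (others-unique v)) (Unique.filter⁺ (∁? ofColour?) (rainbow-unique star))
          (λ (u∈class , u∈leaves) → proj₂ (∈-filter⁻ (∁? ofColour?) {xs = us} u∈leaves)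
                                       (proj₂ (∈-filter⁻ ofColour? {xs = others v} u∈class)))

  monochromatic⇒monDeg≥ : ∀ {us a} → Unique us → All (λ u → u ≢ v × col c v u ≡ a) us → length us ≤ monDeg c v a
  monochromatic⇒monDeg≥ {us} {a} us! inClass = unique-⊆⇒length≤ us (colourClass a) us!
    (λ u∈ → let (u≢v , colour≡a) = All.lookup inClass u∈ in ∈-filter⁺ (λ u → col c v u ≟ a) (∈-others⁺ u≢v) colour≡a)

  colours⊆⇒colDeg≤ : ∀ {ys} → (∀ u → u ≢ v → col c v u ∈ ys) → colDeg c v ≤ length ys
  colours⊆⇒colDeg≤ {ys} allowed = unique-⊆⇒length≤ _ ys (deduplicate-! (map (col c v) (others v))) coloursIn
    where
    coloursIn : deduplicate _≟_ (map (col c v) (others v)) ⊆ ys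
    coloursIn a∈ with ∈-map⁻ (col c v) (∈-deduplicate⁻ _≟_ (map (col c v) (others v)) a∈)
    ... | u , u∈ , refl = allowed u (∈-others⁻ u∈)

telescope : ∀ {L oI iI C′ oy C iy} → L + oI ≤ C′ + iI → C′ + oy ≤ C + iy → L + (oy + oI) ≤ C + (iy + iI)
telescope {L} {oI} {iI} {C′} {oy} {C} {iy} later now = +-cancelˡ-≤ C′ _ _
  (subst₂ _≤_ (lhs L oI C′ oy) (rhs C′ iI C iy) (+-mono-≤ later now))
  where
  lhs : ∀ L oI C′ oy → (L + oI) + (C′ + oy) ≡ C′ + (L + (oy + oI))
  lhs = solve-∀
  rhs : ∀ C′ iI C iy → (C′ + iI) + (C + iy) ≡ C′ + (C + (iy + iI))
  rhs = solve-∀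

path-ends : ∀ {L oI iI C ox ix oq iq} → L + oI ≤ C + iI → oq ≤ L + iq → ox + C ≤ 2 + ix →
  ox + (oI + oq) ≤ (ix + (iI + iq)) + 2
path-ends {L} {oI} {iI} {C} {ox} {ix} {oq} {iq} middle last first = +-cancelˡ-≤ (L + C) _ _
  (subst₂ _≤_ (lhs L oI C ox oq) (rhs L iI C ix iq) (+-mono-≤ (+-mono-≤ middle last) first))
  where
  lhs : ∀ L oI C ox oq → (L + oI) + oq + (ox + C) ≡ (L + C) + (ox + (oI + oq))
  lhs = solve-∀
  rhs : ∀ L iI C ix iq → (C + iI) + (L + iq) + (2 + ix) ≡ (L + C) + ((ix + (iI + iq)) + 2)
  rhs = solve-∀

cycle-arith : ∀ m {k o i r} → k ≡ o + i + r → o ≤ i → i ≤ m → r ≤ 1 → k < 2 * suc m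
cycle-arith m {o = o} {i} {r} refl o≤i i≤m r≤1 = begin-strict
  o + i + r       ≤⟨ +-mono-≤ (+-mono-≤ (≤-trans o≤i i≤m) i≤m) r≤1 ⟩
  m + m + 1       <⟨ n<1+n (m + m + 1) ⟩
  suc (m + m + 1) ≡⟨ closed-form m ⟩
  2 * suc m       ∎
  where
  open ≤-Reasoning
  closed-form : ∀ m → suc (m + m + 1) ≡ 2 * suc m
  closed-form = solve-∀

path-arith : ∀ m {k o i r} → suc k ≡ o + i + r → o ≤ i + 2 → i ≤ m → r ≤ 1 → k < 2 * suc m + 1
path-arith m {k} {o} {i} {r} len o≤i+2 i≤m r≤1 = begin
  suc k           ≡⟨ len ⟩
  o + i + r       ≤⟨ +-mono-≤ (+-mono-≤ (≤-trans o≤i+2 (+-monoˡ-≤ 2 i≤m)) i≤m) r≤1 ⟩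
  m + 2 + m + 1   ≡⟨ closed-form m ⟩
  2 * suc m + 1   ∎
  where
  open ≤-Reasoning
  closed-form : ∀ m → m + 2 + m + 1 ≡ 2 * suc m + 1
  closed-form = solve-∀

module Construction (m n : ℕ) (2ℓ≤n : 2 * suc m ≤ n) where

  ℓ : ℕ
  ℓ = suc m

  0<ℓ : 0 < ℓ
  0<ℓ = s≤s z≤n

  ℓ<n : ℓ < n
  ℓ<n = <-≤-trans (m<m+n ℓ 0<ℓ) (subst (_≤ n) (cong (ℓ +_) (+-identityʳ ℓ)) 2ℓ≤n)

  colour : ℕ → ℕ → ℕ
  colour a b with a <? ℓ | b <? ℓ
  ... | yes _ | yes _ = ℓ + a + b
  ... | yes _ | no _  = a
  ... | no _  | yes _ = b
  ... | no _  | no _  = 0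

  colour-core-core : ∀ {a b} → a < ℓ → b < ℓ → colour a b ≡ ℓ + a + b
  colour-core-core {a} {b} a<ℓ b<ℓ with a <? ℓ | b <? ℓ
  ... | yes _ | yes _ = refl
  ... | no a≮ℓ | _ = ⊥-elim (a≮ℓ a<ℓ)
  ... | yes _ | no b≮ℓ = ⊥-elim (b≮ℓ b<ℓ)

  colour-core-outer : ∀ {a b} → a < ℓ → ℓ ≤ b → colour a b ≡ a
  colour-core-outer {a} {b} a<ℓ ℓ≤b with a <? ℓ | b <? ℓ
  ... | yes _ | no _ = refl
  ... | no a≮ℓ | _ = ⊥-elim (a≮ℓ a<ℓ)
  ... | yes _ | yes b<ℓ = ⊥-elim (<⇒≱ b<ℓ ℓ≤b)

  colour-outer-core : ∀ {a b} → ℓ ≤ a → b < ℓ → colour a b ≡ b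
  colour-outer-core {a} {b} ℓ≤a b<ℓ with a <? ℓ | b <? ℓ
  ... | no _ | yes _ = refl
  ... | yes a<ℓ | _ = ⊥-elim (<⇒≱ a<ℓ ℓ≤a)
  ... | no _ | no b≮ℓ = ⊥-elim (b≮ℓ b<ℓ)

  colour-outer-outer : ∀ {a b} → ℓ ≤ a → ℓ ≤ b → colour a b ≡ 0
  colour-outer-outer {a} {b} ℓ≤a ℓ≤b with a <? ℓ | b <? ℓ
  ... | no _ | no _ = refl
  ... | yes a<ℓ | _ = ⊥-elim (<⇒≱ a<ℓ ℓ≤a)
  ... | no _ | yes b<ℓ = ⊥-elim (<⇒≱ b<ℓ ℓ≤b)

  colour-sym : ∀ a b → colour a b ≡ colour b a
  colour-sym a b with a <? ℓ | b <? ℓ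
  ... | yes _ | yes _ = trans (+-assoc ℓ a b) (trans (cong (ℓ +_) (+-comm a b)) (sym (+-assoc ℓ b a)))
  ... | yes _ | no _  = refl
  ... | no _  | yes _ = refl
  ... | no _  | no _  = refl

  C : EdgeColouring n
  C = record { col = λ u v → colour (toℕ u) (toℕ v) ; sym = λ u v → colour-sym (toℕ u) (toℕ v) }

  below-core-colour : ∀ p j → p < ℓ + p + j
  below-core-colour p j = ≤-trans (s≤s (m≤n+m p m)) (m≤m+n (ℓ + p) j)

  -- The rainbow star at the vertex with label p: the core vertices, except
  -- that p itself (if it is a core vertex) is replaced by the outer vertex ℓ.
  leafLabel : ℕ → ℕ → ℕ
  leafLabel p j with j ≟ p
  ... | yes _ = ℓ
  ... | no _  = j

  leafLabel<n : ∀ p {j} → j < ℓ → leafLabel p j < n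
  leafLabel<n p {j} j<ℓ with j ≟ p
  ... | yes _ = ℓ<n
  ... | no _  = <-trans j<ℓ ℓ<n

  leafLabel≢ : ∀ p {j} → j < ℓ → leafLabel p j ≢ p
  leafLabel≢ p {j} j<ℓ with j ≟ p
  ... | yes refl = λ ℓ≡j → <-irrefl (sym ℓ≡j) j<ℓ
  ... | no j≢p   = j≢p

  -- An outer vertex sees the core vertex j in colour j; a core vertex p sees
  -- ℓ in colour p and the other core vertices j in colours ℓ + p + j.
  leafColour-injective : ∀ p {i j} → i < ℓ → j < ℓ →
    colour p (leafLabel p i) ≡ colour p (leafLabel p j) → i ≡ j
  leafColour-injective p {i} {j} i<ℓ j<ℓ same with ℓ ≤? p | i ≟ p | j ≟ p
  ... | no _ | yes refl | yes refl = refl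
  ... | no ℓ≰p | yes refl | no _ =
    ⊥-elim (<-irrefl (trans (sym (colour-core-outer (≰⇒> ℓ≰p) ≤-refl)) (trans same (colour-core-core (≰⇒> ℓ≰p) j<ℓ))) (below-core-colour p j))
  ... | no ℓ≰p | no _ | yes refl =
    ⊥-elim (<-irrefl (trans (sym (colour-core-outer (≰⇒> ℓ≰p) ≤-refl)) (trans (sym same) (colour-core-core (≰⇒> ℓ≰p) i<ℓ))) (below-core-colour p i))
  ... | no ℓ≰p | no _ | no _ =
    +-cancelˡ-≡ (ℓ + p) i j (trans (sym (colour-core-core (≰⇒> ℓ≰p) i<ℓ)) (trans same (colour-core-core (≰⇒> ℓ≰p) j<ℓ)))
  ... | yes ℓ≤p | yes refl | _ = ⊥-elim (<⇒≱ i<ℓ ℓ≤p)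
  ... | yes ℓ≤p | no _ | yes refl = ⊥-elim (<⇒≱ j<ℓ ℓ≤p)
  ... | yes ℓ≤p | no _ | no _ =
    trans (sym (colour-outer-core ℓ≤p i<ℓ)) (trans same (colour-outer-core ℓ≤p j<ℓ))

  leaf : Fin n → Fin ℓ → Fin n
  leaf v j = fromℕ< (leafLabel<n (toℕ v) (toℕ<n j))

  toℕ-leaf : ∀ v j → toℕ (leaf v j) ≡ leafLabel (toℕ v) (toℕ j)
  toℕ-leaf v j = toℕ-fromℕ< (leafLabel<n (toℕ v) (toℕ<n j))

  rainbowStar : Fin n → List (Fin n)
  rainbowStar v = tabulate (leaf v)

  rainbowStar-isRainbow : ∀ v → RainbowStar C v (rainbowStar v)
  rainbowStar-isRainbow v =
      AllProps.tabulate⁺ (λ j leaf≡v → leafLabel≢ (toℕ v) (toℕ<n j) (trans (sym (toℕ-leaf v j)) (cong toℕ leaf≡v)))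
    , AllPairs.tabulate⁺ (λ {i} {j} i≢j same → i≢j (toℕ-injective
        (leafColour-injective (toℕ v) (toℕ<n i) (toℕ<n j)
          (subst₂ (λ a b → colour (toℕ v) a ≡ colour (toℕ v) b) (toℕ-leaf v i) (toℕ-leaf v j) same))))

  ℓ≤colDeg : ∀ v → ℓ ≤ colDeg C v
  ℓ≤colDeg v = subst (_≤ colDeg C v) (length-tabulate (leaf v)) (rainbow⇒colDeg≥ C v (rainbowStar-isRainbow v))

  monDeg≤n∸ℓ : ∀ v a → monDeg C v a ≤ n ∸ ℓ
  monDeg≤n∸ℓ v a = m+n≤o⇒m≤o∸n (monDeg C v a)
    (subst (λ k → monDeg C v a + k ≤ n) (length-tabulate (leaf v)) (rainbow⇒monDeg≤ C v (rainbowStar-isRainbow v) a))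

  -- The origin, the vertex with label 0, attains both extremes.
  origin : Fin n
  origin = fromℕ< (<-trans 0<ℓ ℓ<n)

  toℕ-origin : toℕ origin ≡ 0
  toℕ-origin = toℕ-fromℕ< (<-trans 0<ℓ ℓ<n)

  outer<n : (j : Fin (n ∸ ℓ)) → ℓ + toℕ j < n
  outer<n j = subst (ℓ + toℕ j <_) (m+[n∸m]≡n (<⇒≤ ℓ<n)) (+-monoʳ-< ℓ (toℕ<n j))

  outerVertex : Fin (n ∸ ℓ) → Fin n
  outerVertex j = fromℕ< (outer<n j)

  outerVertices-unique : Unique (tabulate outerVertex)
  outerVertices-unique = Unique.tabulate⁺ λ {i} {j} same → toℕ-injective (+-cancelˡ-≡ ℓ (toℕ i) (toℕ j)
    (trans (sym (toℕ-fromℕ< (outer<n i))) (trans (cong toℕ same) (toℕ-fromℕ< (outer<n j)))))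

  outerVertices-colour0 : All (λ u → u ≢ origin × col C origin u ≡ 0) (tabulate outerVertex)
  outerVertices-colour0 = AllProps.tabulate⁺ λ j →
      (λ u≡origin → 0≢1+n (trans (sym toℕ-origin) (trans (cong toℕ (sym u≡origin)) (toℕ-fromℕ< (outer<n j)))))
    , trans (cong₂ colour toℕ-origin (toℕ-fromℕ< (outer<n j))) (colour-core-outer 0<ℓ (m≤m+n ℓ (toℕ j)))

  n∸ℓ≤monDeg : n ∸ ℓ ≤ monDeg C origin 0
  n∸ℓ≤monDeg = subst (_≤ monDeg C origin 0) (length-tabulate outerVertex)
    (monochromatic⇒monDeg≥ C origin outerVertices-unique outerVertices-colour0)

  -- the origin sees colour 0 towards the outer vertices and colour ℓ + j
  -- towards the core vertex j ≠ 0: exactly ℓ colours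
  originColours : List ℕ
  originColours = 0 ∷ applyUpTo (λ j → ℓ + suc j) m

  colour-at-origin : ∀ b → b ≢ 0 → colour 0 b ∈ originColours
  colour-at-origin zero 0≢0 = ⊥-elim (0≢0 refl)
  colour-at-origin (suc j) _ with ℓ ≤? suc j
  ... | yes ℓ≤b = here (colour-core-outer 0<ℓ ℓ≤b)
  ... | no ℓ≰b = there (subst (_∈ applyUpTo (λ j → ℓ + suc j) m)
        (sym (trans (colour-core-core 0<ℓ (≰⇒> ℓ≰b)) (cong (_+ suc j) (+-identityʳ ℓ))))
        (∈-applyUpTo⁺ (λ j → ℓ + suc j) (≤-pred (≰⇒> ℓ≰b))))

  colDeg-origin≤ℓ : colDeg C origin ≤ ℓ
  colDeg-origin≤ℓ = subst (colDeg C origin ≤_) (cong suc (length-applyUpTo (λ j → ℓ + suc j) m))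
    (colours⊆⇒colDeg≤ C origin λ u u≢origin → subst (λ a → colour a (toℕ u) ∈ originColours) (sym toℕ-origin)
      (colour-at-origin (toℕ u) (λ u≡0 → u≢origin (toℕ-injective (trans u≡0 (sym toℕ-origin))))))

  maxMonDeg : MaxMonDegIs C (n ∸ ℓ)
  maxMonDeg = monDeg≤n∸ℓ , origin , 0 , ≤-antisym (monDeg≤n∸ℓ origin 0) n∸ℓ≤monDeg

  minColDeg : MinColDegIs C ℓ
  minColDeg = ℓ≤colDeg , origin , ≤-antisym colDeg-origin≤ℓ (ℓ≤colDeg origin)

  data Kind : Set where
    root inner outer : Kind

  _≟ᴷ_ : (k k′ : Kind) → Dec (k ≡ k′)
  root  ≟ᴷ root  = yes refl
  inner ≟ᴷ inner = yes refl
  outer ≟ᴷ outer = yes refl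
  root  ≟ᴷ inner = no λ ()
  root  ≟ᴷ outer = no λ ()
  inner ≟ᴷ root  = no λ ()
  inner ≟ᴷ outer = no λ ()
  outer ≟ᴷ root  = no λ ()
  outer ≟ᴷ inner = no λ ()

  kind : ℕ → Kind
  kind zero = root
  kind (suc a) with suc a <? ℓ
  ... | yes _ = inner
  ... | no _  = outer

  IsKind : Kind → ℕ → Set
  IsKind root  a = a ≡ 0
  IsKind inner a = 0 < a × a < ℓ
  IsKind outer a = ℓ ≤ a

  kindOf : Fin n → Kind
  kindOf v = kind (toℕ v)

  kindOf-spec : ∀ v → IsKind (kindOf v) (toℕ v)
  kindOf-spec v with toℕ v
  ... | zero = refl
  ... | suc a with suc a <? ℓ
  ...   | yes a<ℓ = s≤s z≤n , a<ℓ
  ...   | no a≮ℓ  = ≮⇒≥ a≮ℓ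

  count : Kind → List (Fin n) → ℕ
  count k vs = length (filter (λ v → kindOf v ≟ᴷ k) vs)

  count-++ : ∀ k xs ys → count k (xs ++ ys) ≡ count k xs + count k ys
  count-++ k xs ys = trans (cong length (filter-++ (λ v → kindOf v ≟ᴷ k) xs ys)) (length-++ (filter _ xs))

  count-total : ∀ vs → length vs ≡ count outer vs + count inner vs + count root vs
  count-total [] = refl
  count-total (v ∷ vs) with kindOf v
  ... | outer = cong suc (count-total vs)
  ... | inner = trans (cong suc (count-total vs)) (cong (_+ count root vs) (sym (+-suc (count outer vs) _)))
  ... | root  = trans (cong suc (count-total vs)) (sym (+-suc (count outer vs + count inner vs) _))

  count≤labels : ∀ k ys {vs} → (∀ {a} → IsKind k a → a ∈ ys) → Unique vs → count k vs ≤ length ys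
  count≤labels k ys {vs} labelled vs! = subst (_≤ length ys) (length-map toℕ ofKind)
    (unique-⊆⇒length≤ (map toℕ ofKind) ys (Unique.map⁺ toℕ-injective (Unique.filter⁺ ofKind? vs!)) labelsIn)
    where
    ofKind? : (v : Fin n) → Dec (kindOf v ≡ k)
    ofKind? v = kindOf v ≟ᴷ k

    ofKind : List (Fin n)
    ofKind = filter ofKind? vs

    labelsIn : map toℕ ofKind ⊆ ys
    labelsIn a∈ with ∈-map⁻ toℕ a∈
    ... | v , v∈ , refl = labelled (subst (λ k′ → IsKind k′ (toℕ v)) (proj₂ (∈-filter⁻ ofKind? {xs = vs} v∈)) (kindOf-spec v))

  count-inner≤ : ∀ {vs} → Unique vs → count inner vs ≤ m
  count-inner≤ {vs} vs! = subst (count inner vs ≤_) (length-applyUpTo suc m)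
    (count≤labels inner (applyUpTo suc m) (λ { {suc a} (_ , s≤s a<m) → ∈-applyUpTo⁺ suc a<m }) vs!)

  count-root≤ : ∀ {vs} → Unique vs → count root vs ≤ 1
  count-root≤ vs! = count≤labels root (0 ∷ []) here vs!

  credit : Kind → Kind → ℕ
  credit inner outer = 2
  credit outer inner = 0
  credit _     _     = 1

  edgeCredit : Fin n → Fin n → ℕ
  edgeCredit x y = credit (kindOf x) (kindOf y)

  inner-between-outers : ∀ {a b d} → ℓ ≤ a → b < ℓ → ℓ ≤ d → colour a b ≡ colour b d
  inner-between-outers ℓ≤a b<ℓ ℓ≤d = trans (colour-outer-core ℓ≤a b<ℓ) (sym (colour-core-outer b<ℓ ℓ≤d))

  outer-between-nonInners : ∀ {a b d} → (a ≡ 0 ⊎ ℓ ≤ a) → ℓ ≤ b → (d ≡ 0 ⊎ ℓ ≤ d) → colour a b ≡ colour b d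
  outer-between-nonInners {a} {b} {d} a-ok ℓ≤b d-ok =
    trans (towardsOuter a-ok) (sym (trans (colour-sym b d) (towardsOuter d-ok)))
    where
    towardsOuter : ∀ {c} → (c ≡ 0 ⊎ ℓ ≤ c) → colour c b ≡ 0
    towardsOuter (inj₁ refl) = colour-core-outer 0<ℓ ℓ≤b
    towardsOuter (inj₂ ℓ≤c)  = colour-outer-outer ℓ≤c ℓ≤b

  -- Window lemma: at the middle vertex y of a properly coloured window xyz,
  -- passing an outer vertex costs one unit of credit and passing an inner
  -- vertex earns at most one; the failing patterns are monochromatic.
  window : ∀ {x y z} → col C x y ≢ col C y z →
    edgeCredit y z + count outer (y ∷ []) ≤ edgeCredit x y + count inner (y ∷ [])
  window {x} {y} {z} proper
    with kindOf x | kindOf-spec x | kindOf y | kindOf-spec y | kindOf z | kindOf-spec z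
  ... | root  | _   | root  | _   | _     | _   = ≤-refl
  ... | inner | _   | root  | _   | _     | _   = ≤-refl
  ... | outer | _   | root  | _   | _     | _   = ≤-refl
  ... | outer | ℓ≤a | inner | (_ , b<ℓ) | outer | ℓ≤d = ⊥-elim (proper (inner-between-outers ℓ≤a b<ℓ ℓ≤d))
  ... | root  | _   | inner | _   | outer | _   = ≤-refl
  ... | inner | _   | inner | _   | outer | _   = ≤-refl
  ... | kx    | _   | inner | _   | inner | _   = m≤n+m 1 (credit kx inner)
  ... | kx    | _   | inner | _   | root  | _   = m≤n+m 1 (credit kx inner)
  ... | root  | _   | outer | _   | inner | _   = ≤-refl
  ... | inner | _   | outer | _   | inner | _   = s≤s z≤n
  ... | outer | _   | outer | _   | inner | _   = ≤-refl
  ... | inner | _   | outer | _   | root  | _   = ≤-refl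
  ... | inner | _   | outer | _   | outer | _   = ≤-refl
  ... | root  | a≡0 | outer | ℓ≤b | root  | d≡0 = ⊥-elim (proper (outer-between-nonInners (inj₁ a≡0) ℓ≤b (inj₁ d≡0)))
  ... | root  | a≡0 | outer | ℓ≤b | outer | ℓ≤d = ⊥-elim (proper (outer-between-nonInners (inj₁ a≡0) ℓ≤b (inj₂ ℓ≤d)))
  ... | outer | ℓ≤a | outer | ℓ≤b | root  | d≡0 = ⊥-elim (proper (outer-between-nonInners (inj₂ ℓ≤a) ℓ≤b (inj₁ d≡0)))
  ... | outer | ℓ≤a | outer | ℓ≤b | outer | ℓ≤d = ⊥-elim (proper (outer-between-nonInners (inj₂ ℓ≤a) ℓ≤b (inj₂ ℓ≤d)))

  lastEdge : Fin n → Fin n → List (Fin n) → Fin n × Fin n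
  lastEdge x y []         = x , y
  lastEdge x y (z ∷ rest) = lastEdge y z rest

  interior : Fin n → Fin n → List (Fin n) → List (Fin n)
  interior x y []         = []
  interior x y (z ∷ rest) = y ∷ interior y z rest

  discharge : ∀ x y rest → ProperSeq C (x ∷ y ∷ rest) →
    uncurry edgeCredit (lastEdge x y rest) + count outer (interior x y rest)
      ≤ edgeCredit x y + count inner (interior x y rest)
  discharge x y []         _                 = ≤-refl
  discharge x y (z ∷ rest) (step proper walk) =
    subst₂ (λ o i → uncurry edgeCredit (lastEdge y z rest) + o ≤ edgeCredit x y + i)
      (sym (count-++ outer (y ∷ []) (interior y z rest))) (sym (count-++ inner (y ∷ []) (interior y z rest)))
      (telescope {L = uncurry edgeCredit (lastEdge y z rest)} {C′ = edgeCredit y z} {C = edgeCredit x y}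
        (discharge y z rest walk) (window {x} {y} {z} proper))

  -- Closing a walk into a cycle: first and last edge coincide, and the
  -- interior is a rotation of the cycle.
  lastEdge-closed : ∀ x y ws p q → lastEdge x y (ws ++ p ∷ q ∷ []) ≡ (p , q)
  lastEdge-closed x y []       p q = refl
  lastEdge-closed x y (w ∷ ws) p q = lastEdge-closed y w ws p q

  interior-closed : ∀ x y ws p q → interior x y (ws ++ p ∷ q ∷ []) ≡ y ∷ ws ++ p ∷ []
  interior-closed x y []       p q = refl
  interior-closed x y (w ∷ ws) p q = cong (y ∷_) (interior-closed y w ws p q)

  count-rotate : ∀ k a bs → count k (bs ++ a ∷ []) ≡ count k (a ∷ bs)
  count-rotate k a bs = trans (count-++ k bs (a ∷ [])) (trans (+-comm (count k bs) _) (sym (count-++ k (a ∷ []) bs)))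

  cycle-balance : ∀ a b rest → ProperSeq C ((a ∷ b ∷ rest) ++ a ∷ b ∷ []) →
    count outer (a ∷ b ∷ rest) ≤ count inner (a ∷ b ∷ rest)
  cycle-balance a b rest closed = +-cancelˡ-≤ (edgeCredit a b) _ _ (begin
    edgeCredit a b + count outer (a ∷ b ∷ rest)
      ≡⟨ cong₂ (λ e c → uncurry edgeCredit e + c) (sym (lastEdge-closed a b rest a b)) (sym (rotated outer)) ⟩
    uncurry edgeCredit (lastEdge a b walk) + count outer (interior a b walk)
      ≤⟨ discharge a b walk closed ⟩
    edgeCredit a b + count inner (interior a b walk)
      ≡⟨ cong (edgeCredit a b +_) (rotated inner) ⟩
    edgeCredit a b + count inner (a ∷ b ∷ rest) ∎)
    where
    open ≤-Reasoning
    walk : List (Fin n)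
    walk = rest ++ a ∷ b ∷ []

    rotated : ∀ k → count k (interior a b walk) ≡ count k (a ∷ b ∷ rest)
    rotated k = trans (cong (count k) (interior-closed a b rest a b)) (count-rotate k a (b ∷ rest))

  interior-last : ∀ x y rest → y ∷ rest ≡ interior x y rest ++ proj₂ (lastEdge x y rest) ∷ []
  interior-last x y []         = refl
  interior-last x y (z ∷ rest) = cong (y ∷_) (interior-last y z rest)

  first-edge : ∀ x y → count outer (x ∷ []) + edgeCredit x y ≤ 2 + count inner (x ∷ [])
  first-edge x y with kindOf x | kindOf y
  ... | root  | _     = s≤s z≤n
  ... | inner | outer = s≤s (s≤s z≤n)
  ... | inner | inner = s≤s z≤n
  ... | inner | root  = s≤s z≤n
  ... | outer | outer = ≤-refl
  ... | outer | inner = s≤s z≤n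
  ... | outer | root  = ≤-refl

  last-edge : ∀ p q → count outer (q ∷ []) ≤ edgeCredit p q + count inner (q ∷ [])
  last-edge p q with kindOf p | kindOf q
  ... | _     | root  = z≤n
  ... | _     | inner = z≤n
  ... | root  | outer = ≤-refl
  ... | inner | outer = s≤s z≤n
  ... | outer | outer = ≤-refl

  path-balance : ∀ vs → ProperSeq C vs → count outer vs ≤ count inner vs + 2
  path-balance []      _ = z≤n
  path-balance (x ∷ []) _ with kindOf x
  ... | root  = z≤n
  ... | inner = z≤n
  ... | outer = s≤s z≤n
  path-balance (x ∷ y ∷ rest) walk =
    subst₂ _≤_ (sym (split outer)) (cong (_+ 2) (sym (split inner)))
      (path-ends {L = uncurry edgeCredit (lastEdge x y rest)} {C = edgeCredit x y}
        (discharge x y rest walk) (last-edge (proj₁ (lastEdge x y rest)) q) (first-edge x y))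
    where
    q : Fin n
    q = proj₂ (lastEdge x y rest)

    I : List (Fin n)
    I = interior x y rest

    split : ∀ k → count k (x ∷ y ∷ rest) ≡ count k (x ∷ []) + (count k I + count k (q ∷ []))
    split k = trans (count-++ k (x ∷ []) (y ∷ rest))
      (cong (count k (x ∷ []) +_) (trans (cong (count k) (interior-last x y rest)) (count-++ k I (q ∷ []))))

  -- Length bounds: by pigeonhole a path or cycle meets at most m inner
  -- vertices and the origin at most once.
  cycle-length : ∀ k → PCCycle C k → k < 2 * ℓ
  cycle-length k ([]     , 3≤k , refl , _) = ⊥-elim (<⇒≱ 3≤k z≤n)
  cycle-length k (_ ∷ [] , 3≤k , refl , _) = ⊥-elim (<⇒≱ 3≤k (s≤s z≤n))
  cycle-length k (a ∷ b ∷ rest , _ , len , distinct , closed) =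
    cycle-arith m (trans (sym len) (count-total (a ∷ b ∷ rest)))
      (cycle-balance a b rest closed) (count-inner≤ distinct) (count-root≤ distinct)

  path-length : ∀ k → PCPath C k → k < 2 * ℓ + 1
  path-length k (vs , len , distinct , walk) =
    path-arith m (trans (sym len) (count-total vs))
      (path-balance vs walk) (count-inner≤ distinct) (count-root≤ distinct)

proposition2p3 : (ℓ n : ℕ) → 1 ≤ ℓ → 2 * ℓ ≤ n →
    Σ (EdgeColouring n) λ c →
      MaxMonDegIs c (n ∸ ℓ) × MinColDegIs c ℓ
      × (∀ k → PCCycle c k → k < 2 * ℓ)
      × (∀ k → PCPath c k → k < 2 * ℓ + 1)
proposition2p3 zero    n () _
proposition2p3 (suc m) n _  2ℓ≤n = C , maxMonDeg , minColDeg , cycle-length , path-length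
  where open Construction m n 2ℓ≤n
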